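{- Let $r,m \in \mathbb{N}$ with $r \ge 2$ and $m \equiv 0 \pmod{r}$. Then there exists an edge-coloured graph $G$ on $(r^2 -2)m$ vertices with $\delta^c(G) = (r^2-r-1)m-1$ which does not contain a perfect rainbow-$K_r$-tiling.
   Context: An edge-coloured graph is a (finite, simple) graph together with an assignment of a colour to each edge. The colour degree of a vertex $v$ is the number of distinct colours on edges incident to $v$; $\delta^c(G)$ is the minimum colour degree over all vertices of $G$. A subgraph is rainbow if all its edges have distinct colours. A rainbow-$K_r$-tiling is a collection of vertex-disjoint rainbow copies of $K_r$ (colours may repeat between different copies); it is perfect if it covers all vertices of $G$. -}

module Defs where

open import Data.Nat using (ℕ; _<_; _≡ᵇ_)
open import Data.Nat.Properties using (_≟_)
open import Data.Bool using (Bool; true; false; T)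
open import Data.Fin using (Fin) renaming (_<_ to _<ᶠ_)
open import Data.List using (List; length; map; filter; deduplicate)
open import Data.List.Base using ()
open import Data.Fin.Base using ()
open import Data.List.Base using (allFin)
open import Data.Product using (Σ; ∃; _×_; _,_)
open import Data.Sum using (_⊎_)
open import Relation.Binary.PropositionalEquality using (_≡_; _≢_)
open import Relation.Nullary using (¬_)
open import Relation.Nullary.Decidable using (Dec)
open import Relation.Unary using (Pred)
open import Function.Definitions using (Injective; Surjective)

-- A finite simple graph on vertex set Fin n, given by a Boolean adjacency
-- relation (symmetric, irreflexive), together with an edge-colouring:
-- colour : Fin n → Fin n → ℕ, symmetric (only values on edges matter).
record ColouredGraph (n : ℕ) : Set where
  field
    adj      : Fin n → Fin n → Bool
    adj-sym  : ∀ u v → adj u v ≡ adj v u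
    adj-irr  : ∀ v → adj v v ≡ false
    colour   : Fin n → Fin n → ℕ
    col-sym  : ∀ u v → colour u v ≡ colour v u

open ColouredGraph public

Edge : ∀ {n} → ColouredGraph n → Fin n → Fin n → Set
Edge G u v = T (adj G u v)

nbrs : ∀ {n} → ColouredGraph n → Fin n → List (Fin n)
nbrs G v = filter (λ u → T? (adj G v u)) (allFin _)
  where
  open import Data.Bool.Properties using (T?)

colourDegree : ∀ {n} → ColouredGraph n → Fin n → ℕ
colourDegree G v = length (deduplicate _≟_ (map (colour G v) (nbrs G v)))

-- minimum colour degree δ^c(G) = d : every vertex has colour degree ≥ d,
-- and some vertex attains d.  (For n = 0 we adopt: no vertex attains it,
-- but the theorem only uses n ≥ 1 vertices when m ≥ 1.)
MinColourDegree : ∀ {n} → ColouredGraph n → ℕ → Set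
MinColourDegree {n} G d =
  (∀ v → d Data.Nat.≤ colourDegree G v) × (∃ λ v → colourDegree G v ≡ d)

IsClique : ∀ {n r} → ColouredGraph n → (Fin r → Fin n) → Set
IsClique G f = Injective _≡_ _≡_ f × (∀ a b → a ≢ b → Edge G (f a) (f b))

IsRainbow : ∀ {n r} → ColouredGraph n → (Fin r → Fin n) → Set
IsRainbow G f = ∀ a b a' b' → a <ᶠ b → a' <ᶠ b' →
  ¬ (a ≡ a' × b ≡ b') → colour G (f a) (f b) ≢ colour G (f a') (f b')

-- Perfect rainbow-K_r-tiling: k tiles, tile i given by t i : Fin r → Fin n,
-- each a rainbow K_r, with the tiles vertex-disjoint and covering all
-- vertices, i.e. (i , a) ↦ t i a is a bijection Fin k × Fin r → Fin n.
PerfectRainbowTiling : ∀ {n} → ColouredGraph n → ℕ → Set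
PerfectRainbowTiling {n} G r =
  Σ ℕ λ k → Σ (Fin k → Fin r → Fin n) λ t →
    (∀ i → IsClique G (t i) × IsRainbow G (t i)) ×
    Injective _≡_ _≡_ (λ (p : Fin k × Fin r) → t (Data.Product.proj₁ p) (Data.Product.proj₂ p)) ×
    Surjective _≡_ _≡_ (λ (p : Fin k × Fin r) → t (Data.Product.proj₁ p) (Data.Product.proj₂ p))

{-# OPTIONS --safe #-}

-- Let k = r − 1. Take k independent blocks S₁, …, S_k of size m, completely joined to each other,
-- a set A of size k²m − 1 completely joined to S = S₁ ∪ … ∪ S_k, and a set B of size (k − 1)m + 1
-- with no edges to S; A ∪ B is a clique. An edge from S to a ∈ A gets colour a, any other edge uv
-- gets colour N + u + v (N = |V|), so the edges at a vertex have distinct colours except for the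
-- star from a ∈ A to S. Hence a vertex of B has the minimum colour degree |A ∪ B| − 1, which is
-- (r² − r − 1)m − 1. A rainbow K_r contains at most one vertex of S: with two, every other vertex
-- is in S as well, since B misses S and a vertex of A sees both in one colour; but r vertices of S
-- cannot lie in r − 1 independent blocks. So in a perfect tiling each vertex of S has r − 1 tile
-- mates in A, all distinct, and this needs k · |S| = k²m > |A| vertices.

module Submission where

open import Defs
open import Data.Bool using (Bool; true; false; not; _∧_; T)
open import Data.Bool.Properties using (T?; T-∧; T-not-≡)
open import Data.Empty using (⊥; ⊥-elim)
open import Data.Fin as Fin using (Fin; zero; suc; toℕ; _↑ˡ_; _↑ʳ_; splitAt; join; punchIn; combine; remQuot)
import Data.Fin.Properties as Finₚ
open import Data.List using (List; length; lookup; map; allFin)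
import Data.List.Properties as Listₚ
open import Data.List.Membership.Propositional using (_∈_)
open import Data.List.Membership.Propositional.Properties
  using (∈-lookup; ∈-deduplicate⁺; ∈-map⁺; ∈-filter⁺; ∈-filter⁻; ∈-allFin)
open import Data.List.Relation.Unary.Any using (index)
open import Data.List.Relation.Unary.Any.Properties using (lookup-index)
import Data.List.Relation.Unary.All as All
open import Data.List.Relation.Unary.AllPairs using (_∷_)
open import Data.List.Relation.Unary.Unique.Propositional using (Unique)
open import Data.List.Relation.Unary.Unique.Propositional.Properties using (filter⁺; allFin⁺)
open import Data.Nat using (ℕ; zero; suc; pred; _+_; _≤_; _*_; _∸_; s≤s)
open import Data.Nat.Divisibility using (_∣_)
import Data.Nat.Properties as ℕₚ
open import Data.Nat.Tactic.RingSolver using (solve-∀)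
open import Data.Product using (Σ; ∃; _×_; _,_; proj₁; proj₂; uncurry)
open import Data.Sum using (_⊎_; inj₁; inj₂; [_,_]′)
open import Function using (_∘_; case_of_)
open import Function.Bundles using (Equivalence)
open import Function.Definitions using (Injective; Surjective)
open import Relation.Binary.Definitions using (tri<; tri≈; tri>)
open import Relation.Binary.PropositionalEquality
open import Relation.Nullary using (¬_; does; yes; no; contradiction)
open import Relation.Nullary.Decidable using (dec-true; dec-false)

remQuot-injective : ∀ {a} b → Injective _≡_ _≡_ (remQuot {a} b)
remQuot-injective {a} b {x} {y} e = begin
  x                                  ≡⟨ Finₚ.combine-remQuot {a} b x ⟨
  uncurry combine (remQuot {a} b x)  ≡⟨ cong (uncurry combine) e ⟩
  uncurry combine (remQuot {a} b y)  ≡⟨ Finₚ.combine-remQuot {a} b y ⟩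
  y                                  ∎
  where open ≡-Reasoning

splitAt-injective : ∀ a {b} → Injective _≡_ _≡_ (splitAt a {b})
splitAt-injective a {b} {x} {y} e = begin
  x                      ≡⟨ Finₚ.join-splitAt a b x ⟨
  join a b (splitAt a x) ≡⟨ cong (join a b) e ⟩
  join a b (splitAt a y) ≡⟨ Finₚ.join-splitAt a b y ⟩
  y                      ∎
  where open ≡-Reasoning

×-injective⇒≤ : ∀ {a b c} {f : Fin a × Fin b → Fin c} → Injective _≡_ _≡_ f → a * b ≤ c
×-injective⇒≤ {b = b} f-injective = Finₚ.injective⇒≤ (remQuot-injective b ∘ f-injective)

data SplitView (a : ℕ) {b : ℕ} : Fin (a + b) → Set where
  left  : (i : Fin a) → SplitView a (i ↑ˡ b)
  right : (j : Fin b) → SplitView a (a ↑ʳ j)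

splitView : ∀ a {b} (x : Fin (a + b)) → SplitView a x
splitView zero    x       = right x
splitView (suc a) zero    = left zero
splitView (suc a) (suc x) with splitView a x
... | left i  = left (suc i)
... | right j = right j

does-≟-sym : ∀ {n} (i j : Fin n) → does (i Fin.≟ j) ≡ does (j Fin.≟ i)
does-≟-sym i j with i Fin.≟ j
... | yes refl = sym (dec-true (i Fin.≟ i) refl)
... | no i≢j   = sym (dec-false (j Fin.≟ i) (i≢j ∘ sym))

Unique⇒lookup-injective : ∀ {A : Set} {xs : List A} → Unique xs →
                          ∀ i j → lookup xs i ≡ lookup xs j → i ≡ j
Unique⇒lookup-injective (_ ∷ _)      zero    zero    _ = refl
Unique⇒lookup-injective (x∉ ∷ _)     zero    (suc j) e = contradiction e (All.lookup x∉ (∈-lookup j))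
Unique⇒lookup-injective (x∉ ∷ _)     (suc i) zero    e = contradiction (sym e) (All.lookup x∉ (∈-lookup i))
Unique⇒lookup-injective (_ ∷ unique) (suc i) (suc j) e = cong suc (Unique⇒lookup-injective unique i j e)

length-≤-cover : ∀ {A : Set} {k} {xs : List A} → Unique xs → (g : Fin k → A) →
                 (∀ {x} → x ∈ xs → ∃ λ j → g j ≡ x) → length xs ≤ k
length-≤-cover {xs = xs} unique g cover = Finₚ.injective⇒≤ {f = preimage} preimage-injective
  where
  preimage : Fin (length xs) → Fin _
  preimage i = proj₁ (cover (∈-lookup i))

  preimage-injective : Injective _≡_ _≡_ preimage
  preimage-injective {i} {j} e = Unique⇒lookup-injective unique i j (begin
    lookup xs i          ≡⟨ proj₂ (cover (∈-lookup i)) ⟨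
    g (preimage i)       ≡⟨ cong g e ⟩
    g (preimage j)       ≡⟨ proj₂ (cover (∈-lookup j)) ⟩
    lookup xs j          ∎)
    where open ≡-Reasoning

injection-≤-length : ∀ {A : Set} {k} {zs : List A} (g : Fin k → A) → Injective _≡_ _≡_ g →
                     (∀ j → g j ∈ zs) → k ≤ length zs
injection-≤-length {zs = zs} g g-injective g∈zs =
  Finₚ.injective⇒≤ {f = index ∘ g∈zs} λ {i} {j} e → g-injective (begin
    g i                        ≡⟨ lookup-index (g∈zs i) ⟩
    lookup zs (index (g∈zs i)) ≡⟨ cong (lookup zs) e ⟩
    lookup zs (index (g∈zs j)) ≡⟨ lookup-index (g∈zs j) ⟨
    g j                        ∎)
  where open ≡-Reasoning

module _ {n : ℕ} (G : ColouredGraph n) where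

  ∈-nbrs⁺ : ∀ {v u} → Edge G v u → u ∈ nbrs G v
  ∈-nbrs⁺ {v} {u} = ∈-filter⁺ (λ u → T? (adj G v u)) (∈-allFin u)

  ∈-nbrs⁻ : ∀ {v u} → u ∈ nbrs G v → Edge G v u
  ∈-nbrs⁻ {v} = proj₂ ∘ ∈-filter⁻ (λ u → T? (adj G v u)) {xs = allFin n}

  nbrs-unique : ∀ v → Unique (nbrs G v)
  nbrs-unique v = filter⁺ (λ u → T? (adj G v u)) (allFin⁺ n)

  ≤-colourDegree : ∀ {k} v (h : Fin k → Fin n) → (∀ j → Edge G v (h j)) →
                   Injective _≡_ _≡_ (colour G v ∘ h) → k ≤ colourDegree G v
  ≤-colourDegree v h edge colour-injective = injection-≤-length (colour G v ∘ h) colour-injective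
    (λ j → ∈-deduplicate⁺ ℕₚ._≟_ (∈-map⁺ (colour G v) (∈-nbrs⁺ (edge j))))

  colourDegree-≤ : ∀ {k} v (g : Fin k → Fin n) → (∀ {u} → Edge G v u → ∃ λ j → g j ≡ u) →
                   colourDegree G v ≤ k
  colourDegree-≤ {k} v g cover = begin
    colourDegree G v                       ≤⟨ Listₚ.length-deduplicate ℕₚ._≟_ (map (colour G v) (nbrs G v)) ⟩
    length (map (colour G v) (nbrs G v))   ≡⟨ Listₚ.length-map (colour G v) (nbrs G v) ⟩
    length (nbrs G v)                      ≤⟨ length-≤-cover (nbrs-unique v) g (cover ∘ ∈-nbrs⁻) ⟩
    k                                      ∎
    where open ℕₚ.≤-Reasoning

  ≤-colourDegree-⊎ : ∀ {k l} v (h₁ : Fin k → Fin n) (h₂ : Fin l → Fin n) →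
    (∀ i → Edge G v (h₁ i)) → (∀ j → Edge G v (h₂ j)) →
    Injective _≡_ _≡_ (colour G v ∘ h₁) → Injective _≡_ _≡_ (colour G v ∘ h₂) →
    (∀ i j → colour G v (h₁ i) ≢ colour G v (h₂ j)) →
    k + l ≤ colourDegree G v
  ≤-colourDegree-⊎ {k} v h₁ h₂ edge₁ edge₂ injective₁ injective₂ disjoint =
    ≤-colourDegree v (h ∘ splitAt k) (edge ∘ splitAt k) (splitAt-injective k ∘ injective)
    where
    h : Fin _ ⊎ Fin _ → Fin n
    h = [ h₁ , h₂ ]′

    edge : ∀ x → Edge G v (h x)
    edge (inj₁ i) = edge₁ i
    edge (inj₂ j) = edge₂ j

    injective : Injective _≡_ _≡_ (colour G v ∘ h)
    injective {inj₁ i} {inj₁ j} e = cong inj₁ (injective₁ e)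
    injective {inj₁ i} {inj₂ j} e = contradiction e (disjoint i j)
    injective {inj₂ i} {inj₁ j} e = contradiction (sym e) (disjoint j i)
    injective {inj₂ i} {inj₂ j} e = cong inj₂ (injective₂ e)

  Edge-irreflexive : ∀ v → ¬ Edge G v v
  Edge-irreflexive v = subst T (adj-irr G v)

  rainbow⇒incident-colours-≢ : ∀ {r} (f : Fin r → Fin n) → IsRainbow G f →
    ∀ {z x y} → z ≢ x → z ≢ y → x ≢ y → colour G (f z) (f x) ≢ colour G (f z) (f y)
  rainbow⇒incident-colours-≢ f rainbow {z} {x} {y} z≢x z≢y x≢y
    with Finₚ.<-cmp z x | Finₚ.<-cmp z y
  ... | tri≈ _ z≡x _ | _            = contradiction z≡x z≢x
  ... | _            | tri≈ _ z≡y _ = contradiction z≡y z≢y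
  ... | tri< z<x _ _ | tri< z<y _ _ = rainbow z x z y z<x z<y (x≢y ∘ proj₂)
  ... | tri< z<x _ _ | tri> _ _ y<z = λ e →
    rainbow z x y z z<x y<z (z≢y ∘ proj₁) (trans e (col-sym G (f z) (f y)))
  ... | tri> _ _ x<z | tri< z<y _ _ = λ e →
    rainbow x z z y x<z z<y (z≢x ∘ sym ∘ proj₁) (trans (col-sym G (f x) (f z)) e)
  ... | tri> _ _ x<z | tri> _ _ y<z = λ e →
    rainbow x z y z x<z y<z (x≢y ∘ proj₁) (trans (col-sym G (f x) (f z)) (trans e (col-sym G (f z) (f y))))

module _ {n k r : ℕ} (t : Fin k → Fin (suc r) → Fin n)
         (t-injective : Injective _≡_ _≡_ (uncurry t))
         (t-surjective : Surjective _≡_ _≡_ (uncurry t)) where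

  tileMates-count : ∀ {s a} (σ : Fin s → Fin n) (α : Fin a → Fin n) → Injective _≡_ _≡_ σ →
    (∀ j x → α j ≢ σ x) →
    (∀ {x i p p′} → t i p ≡ σ x → p ≢ p′ → ∃ λ j → α j ≡ t i p′) →
    s * r ≤ a
  tileMates-count σ α σ-injective α≢σ mate-in-α = ×-injective⇒≤ mate-injective
    where
    tile : Fin _ → Fin k
    tile x = proj₁ (proj₁ (t-surjective (σ x)))

    position : Fin _ → Fin (suc r)
    position x = proj₂ (proj₁ (t-surjective (σ x)))

    located : ∀ x → t (tile x) (position x) ≡ σ x
    located x = proj₂ (t-surjective (σ x)) refl

    mateAt : ∀ x c → ∃ λ j → α j ≡ t (tile x) (punchIn (position x) c)
    mateAt x c = mate-in-α (located x) (Finₚ.punchInᵢ≢i (position x) c ∘ sym)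

    mate : Fin _ × Fin r → Fin _
    mate (x , c) = proj₁ (mateAt x c)

    mate-injective : Injective _≡_ _≡_ mate
    mate-injective {x , c} {y , d} e = cong₂ _,_ x≡y c≡d
      where
      sameSlot : (tile x , punchIn (position x) c) ≡ (tile y , punchIn (position y) d)
      sameSlot = t-injective (trans (sym (proj₂ (mateAt x c))) (trans (cong α e) (proj₂ (mateAt y d))))

      sameTile : tile x ≡ tile y
      sameTile = cong proj₁ sameSlot

      samePosition : position x ≡ position y
      samePosition with position x Fin.≟ position y
      ... | yes eq = eq
      ... | no ne  = contradiction (trans (proj₂ (mate-in-α (located x) ne))
                                          (trans (cong (λ i → t i (position y)) sameTile) (located y)))
                                   (α≢σ _ y)

      x≡y : x ≡ y
      x≡y = σ-injective (trans (sym (located x)) (trans (cong₂ t sameTile samePosition) (located y)))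

      c≡d : c ≡ d
      c≡d = Finₚ.punchIn-injective (position y) c d
              (trans (cong (λ p → punchIn p c) (sym samePosition)) (cong proj₂ sameSlot))

module Construction (q m′ : ℕ) where

  k m sizeS sizeA sizeB sizeT N δ : ℕ
  k     = suc q
  m     = suc m′
  sizeS = k * m
  sizeA = pred (k * k * m)
  sizeB = suc (q * m)
  sizeT = sizeB + sizeA
  N     = sizeT + sizeS
  δ     = q * m + sizeA

  data Part : Set where
    inS     : Fin k → Part
    inA inB : Part

  blockOf : Fin sizeS → Fin k
  blockOf x = proj₁ (remQuot m x)

  partT : Fin sizeT → Part
  partT t = [ (λ _ → inB) , (λ _ → inA) ]′ (splitAt sizeB t)

  part : Fin N → Part
  part v = [ partT , inS ∘ blockOf ]′ (splitAt sizeT v)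

  linked : Part → Part → Bool
  linked (inS i) (inS j) = not (does (i Fin.≟ j))
  linked (inS _) inB     = false
  linked inB     (inS _) = false
  linked _       _       = true

  plainColour : Fin N → Fin N → ℕ
  plainColour u v = N + (toℕ u + toℕ v)

  colourOf : Part → Part → Fin N → Fin N → ℕ
  colourOf (inS _) inA     u v = toℕ v
  colourOf inA     (inS _) u v = toℕ u
  colourOf _       _       u v = plainColour u v

  linked-sym : ∀ π π′ → linked π π′ ≡ linked π′ π
  linked-sym (inS i) (inS j) = cong not (does-≟-sym i j)
  linked-sym (inS _) inA     = refl
  linked-sym (inS _) inB     = refl
  linked-sym inA     (inS _) = refl
  linked-sym inA     inA     = refl
  linked-sym inA     inB     = refl
  linked-sym inB     (inS _) = refl
  linked-sym inB     inA     = refl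
  linked-sym inB     inB     = refl

  plainColour-sym : ∀ u v → plainColour u v ≡ plainColour v u
  plainColour-sym u v = cong (N +_) (ℕₚ.+-comm (toℕ u) (toℕ v))

  colourOf-sym : ∀ π π′ u v → colourOf π π′ u v ≡ colourOf π′ π v u
  colourOf-sym (inS _) (inS _) u v = plainColour-sym u v
  colourOf-sym (inS _) inA     u v = refl
  colourOf-sym (inS _) inB     u v = plainColour-sym u v
  colourOf-sym inA     (inS _) u v = refl
  colourOf-sym inA     inA     u v = plainColour-sym u v
  colourOf-sym inA     inB     u v = plainColour-sym u v
  colourOf-sym inB     (inS _) u v = plainColour-sym u v
  colourOf-sym inB     inA     u v = plainColour-sym u v
  colourOf-sym inB     inB     u v = plainColour-sym u v

  graph : ColouredGraph N
  graph = record
    { adj     = λ u v → not (does (u Fin.≟ v)) ∧ linked (part u) (part v)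
    ; adj-sym = λ u v → cong₂ (λ e l → not e ∧ l) (does-≟-sym u v) (linked-sym (part u) (part v))
    ; adj-irr = λ v → cong (λ e → not e ∧ linked (part v) (part v)) (dec-true (v Fin.≟ v) refl)
    ; colour  = λ u v → colourOf (part u) (part v) u v
    ; col-sym = λ u v → colourOf-sym (part u) (part v) u v
    }

  sVertex : Fin sizeS → Fin N
  sVertex = sizeT ↑ʳ_

  aVertex : Fin sizeA → Fin N
  aVertex j = (sizeB ↑ʳ j) ↑ˡ sizeS

  bVertex : Fin sizeB → Fin N
  bVertex i = (i ↑ˡ sizeA) ↑ˡ sizeS

  part-↑ˡ : ∀ t → part (t ↑ˡ sizeS) ≡ partT t
  part-↑ˡ t = cong [ partT , inS ∘ blockOf ]′ (Finₚ.splitAt-↑ˡ sizeT t sizeS)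

  part-sVertex : ∀ x → part (sVertex x) ≡ inS (blockOf x)
  part-sVertex x = cong [ partT , inS ∘ blockOf ]′ (Finₚ.splitAt-↑ʳ sizeT sizeS x)

  part-sVertex-combine : ∀ i y → part (sVertex (combine i y)) ≡ inS i
  part-sVertex-combine i y = trans (part-sVertex _) (cong (inS ∘ proj₁) (Finₚ.remQuot-combine i y))

  part-aVertex : ∀ j → part (aVertex j) ≡ inA
  part-aVertex j =
    trans (part-↑ˡ (sizeB ↑ʳ j)) (cong [ (λ _ → inB) , (λ _ → inA) ]′ (Finₚ.splitAt-↑ʳ sizeB sizeA j))

  part-bVertex : ∀ i → part (bVertex i) ≡ inB
  part-bVertex i =
    trans (part-↑ˡ (i ↑ˡ sizeA)) (cong [ (λ _ → inB) , (λ _ → inA) ]′ (Finₚ.splitAt-↑ˡ sizeB i sizeA))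

  linked-T : ∀ t t′ → T (linked (partT t) (partT t′))
  linked-T t t′ with splitAt sizeB t | splitAt sizeB t′
  ... | inj₁ _ | inj₁ _ = _
  ... | inj₁ _ | inj₂ _ = _
  ... | inj₂ _ | inj₁ _ = _
  ... | inj₂ _ | inj₂ _ = _

  colourOf-T : ∀ t t′ u v → colourOf (partT t) (partT t′) u v ≡ plainColour u v
  colourOf-T t t′ u v with splitAt sizeB t | splitAt sizeB t′
  ... | inj₁ _ | inj₁ _ = refl
  ... | inj₁ _ | inj₂ _ = refl
  ... | inj₂ _ | inj₁ _ = refl
  ... | inj₂ _ | inj₂ _ = refl

  edge⇒linked : ∀ u v {π π′} → Edge graph u v → part u ≡ π → part v ≡ π′ → T (linked π π′)
  edge⇒linked _ _ e refl refl = proj₂ (Equivalence.to T-∧ e)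

  linked⇒edge : ∀ u v {π π′} → part u ≡ π → part v ≡ π′ → u ≢ v → T (linked π π′) → Edge graph u v
  linked⇒edge u v refl refl u≢v l =
    Equivalence.from T-∧ (Equivalence.from T-not-≡ (dec-false (u Fin.≟ v) u≢v) , l)

  colour-parts : ∀ u v {π π′} → part u ≡ π → part v ≡ π′ → colour graph u v ≡ colourOf π π′ u v
  colour-parts _ _ refl refl = refl

  colour-S-A : ∀ x j → colour graph (sVertex x) (aVertex j) ≡ toℕ (aVertex j)
  colour-S-A x j = colour-parts (sVertex x) (aVertex j) (part-sVertex x) (part-aVertex j)

  colour-S-S : ∀ x y → colour graph (sVertex x) (sVertex y) ≡ plainColour (sVertex x) (sVertex y)
  colour-S-S x y = colour-parts (sVertex x) (sVertex y) (part-sVertex x) (part-sVertex y)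

  colour-T-T : ∀ t t′ → colour graph (t ↑ˡ sizeS) (t′ ↑ˡ sizeS) ≡ plainColour (t ↑ˡ sizeS) (t′ ↑ˡ sizeS)
  colour-T-T t t′ =
    trans (colour-parts (t ↑ˡ sizeS) (t′ ↑ˡ sizeS) (part-↑ˡ t) (part-↑ˡ t′)) (colourOf-T t t′ _ _)

  plainColour-injectiveʳ : ∀ u {v v′} → plainColour u v ≡ plainColour u v′ → v ≡ v′
  plainColour-injectiveʳ u = Finₚ.toℕ-injective ∘ ℕₚ.+-cancelˡ-≡ (toℕ u) _ _ ∘ ℕₚ.+-cancelˡ-≡ N _ _

  toℕ≢plainColour : ∀ (w u v : Fin N) → toℕ w ≢ plainColour u v
  toℕ≢plainColour w u v = ℕₚ.<⇒≢ (ℕₚ.<-≤-trans (Finₚ.toℕ<n w) (ℕₚ.m≤m+n N _))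

  inS-injective : ∀ {i j} → inS i ≡ inS j → i ≡ j
  inS-injective refl = refl

  linked-inS : ∀ {i j} → i ≢ j → T (linked (inS i) (inS j))
  linked-inS {i} {j} i≢j = Equivalence.from T-not-≡ (dec-false (i Fin.≟ j) i≢j)

  linked-inS⁻ : ∀ {i j} → T (linked (inS i) (inS j)) → i ≢ j
  linked-inS⁻ {i} l refl = subst (T ∘ not) (dec-true (i Fin.≟ i) refl) l

  tNeighbour : Fin sizeT → Fin δ → Fin N
  tNeighbour t j = punchIn t j ↑ˡ sizeS

  δ≤colourDegree-T : ∀ t → δ ≤ colourDegree graph (t ↑ˡ sizeS)
  δ≤colourDegree-T t = ≤-colourDegree graph (t ↑ˡ sizeS) (tNeighbour t) edge injective
    where
    edge : ∀ j → Edge graph (t ↑ˡ sizeS) (tNeighbour t j)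
    edge j = linked⇒edge (t ↑ˡ sizeS) (tNeighbour t j) (part-↑ˡ t) (part-↑ˡ (punchIn t j))
               (Finₚ.punchInᵢ≢i t j ∘ sym ∘ Finₚ.↑ˡ-injective sizeS _ _) (linked-T t (punchIn t j))

    injective : Injective _≡_ _≡_ (colour graph (t ↑ˡ sizeS) ∘ tNeighbour t)
    injective {i} {j} e = Finₚ.punchIn-injective t i j (Finₚ.↑ˡ-injective sizeS _ _
      (plainColour-injectiveʳ (t ↑ˡ sizeS)
        (trans (sym (colour-T-T t (punchIn t i))) (trans e (colour-T-T t (punchIn t j))))))

  otherBlock : Fin k → Fin (q * m) → Fin N
  otherBlock i c = sVertex (combine (punchIn i (proj₁ (remQuot {q} m c))) (proj₂ (remQuot {q} m c)))

  otherBlock-injective : ∀ i → Injective _≡_ _≡_ (otherBlock i)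
  otherBlock-injective i {c} {c′} e
    with b≡b′ , y≡y′ ← Finₚ.combine-injective _ _ _ _ (Finₚ.↑ʳ-injective sizeT _ _ e) =
    remQuot-injective {q} m (cong₂ _,_ (Finₚ.punchIn-injective i _ _ b≡b′) y≡y′)

  δ≤colourDegree-S : ∀ x → δ ≤ colourDegree graph (sVertex x)
  δ≤colourDegree-S x =
    ≤-colourDegree-⊎ graph (sVertex x) (otherBlock i) aVertex edgeS edgeA injectiveS injectiveA disjoint
    where
    i : Fin k
    i = blockOf x

    part-otherBlock : ∀ c → part (otherBlock i c) ≡ inS (punchIn i (proj₁ (remQuot {q} m c)))
    part-otherBlock c = part-sVertex-combine _ _

    edgeS : ∀ c → Edge graph (sVertex x) (otherBlock i c)
    edgeS c = linked⇒edge (sVertex x) (otherBlock i c) (part-sVertex x) (part-otherBlock c)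
      (λ e → i≢punchIn (inS-injective
        (trans (sym (part-sVertex x)) (trans (cong part e) (part-otherBlock c)))))
      (linked-inS i≢punchIn)
      where
      i≢punchIn : i ≢ punchIn i (proj₁ (remQuot {q} m c))
      i≢punchIn = Finₚ.punchInᵢ≢i i _ ∘ sym

    edgeA : ∀ j → Edge graph (sVertex x) (aVertex j)
    edgeA j = linked⇒edge (sVertex x) (aVertex j) (part-sVertex x) (part-aVertex j)
      (λ e → case trans (sym (part-sVertex x)) (trans (cong part e) (part-aVertex j)) of λ ()) _

    injectiveS : Injective _≡_ _≡_ (colour graph (sVertex x) ∘ otherBlock i)
    injectiveS e = otherBlock-injective i
      (plainColour-injectiveʳ (sVertex x) (trans (sym (colour-S-S x _)) (trans e (colour-S-S x _))))

    injectiveA : Injective _≡_ _≡_ (colour graph (sVertex x) ∘ aVertex)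
    injectiveA {j} {j′} e = Finₚ.↑ʳ-injective sizeB _ _ (Finₚ.↑ˡ-injective sizeS _ _ (Finₚ.toℕ-injective
      (trans (sym (colour-S-A x j)) (trans e (colour-S-A x j′)))))

    disjoint : ∀ c j → colour graph (sVertex x) (otherBlock i c) ≢ colour graph (sVertex x) (aVertex j)
    disjoint c j e = toℕ≢plainColour (aVertex j) (sVertex x) (otherBlock i c)
      (trans (sym (colour-S-A x j)) (trans (sym e) (colour-S-S x _)))

  δ≤colourDegree : ∀ v → δ ≤ colourDegree graph v
  δ≤colourDegree v with splitView sizeT v
  ... | left t  = δ≤colourDegree-T t
  ... | right x = δ≤colourDegree-S x

  colourDegree-B≤δ : colourDegree graph (bVertex zero) ≤ δ
  colourDegree-B≤δ = colourDegree-≤ graph (bVertex zero) (tNeighbour zero) cover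
    where
    cover : ∀ {u} → Edge graph (bVertex zero) u → ∃ λ j → tNeighbour zero j ≡ u
    cover {u} e with splitView sizeT u
    ... | left zero    = contradiction e (Edge-irreflexive graph (bVertex zero))
    ... | left (suc j) = j , refl
    ... | right x      =
      ⊥-elim (edge⇒linked (bVertex zero) (sVertex x) e (part-bVertex zero) (part-sVertex x))

  minColourDegree : MinColourDegree graph δ
  minColourDegree =
    δ≤colourDegree , bVertex zero , ℕₚ.≤-antisym colourDegree-B≤δ (δ≤colourDegree (bVertex zero))

  S-neighbour : ∀ x u → Edge graph (sVertex x) u → (∃ λ j → aVertex j ≡ u) ⊎ (∃ λ b → part u ≡ inS b)
  S-neighbour x u e with splitView sizeT u
  ... | right y = inj₂ (blockOf y , part-sVertex y)
  ... | left t with splitView sizeB t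
  ...   | left i  = ⊥-elim (edge⇒linked (sVertex x) (bVertex i) e (part-sVertex x) (part-bVertex i))
  ...   | right j = inj₁ (j , refl)

  module _ (f : Fin (suc k) → Fin N) (clique : IsClique graph f) (rainbow : IsRainbow graph f) where

    rainbowClique-S-unique : ∀ {p p′ i i′} → p ≢ p′ → part (f p) ≡ inS i → part (f p′) ≡ inS i′ → ⊥
    rainbowClique-S-unique {p} {p′} {i} {i′} p≢p′ fp∈S fp′∈S =
      let z , z′ , z<z′ , sameBlock = Finₚ.pigeonhole (ℕₚ.n<1+n k) (proj₁ ∘ blockAt) in
      linked-inS⁻ (edge⇒linked (f z) (f z′) (proj₂ clique z z′ (Finₚ.<⇒≢ z<z′))
                               (proj₂ (blockAt z)) (proj₂ (blockAt z′)))
                  sameBlock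
      where
      blockAt : ∀ z → ∃ λ b → part (f z) ≡ inS b
      blockAt z with z Fin.≟ p | z Fin.≟ p′
      ... | yes refl | _        = i , fp∈S
      ... | no _     | yes refl = i′ , fp′∈S
      ... | no z≢p   | no z≢p′  = classify (part (f z)) refl
        where
        classify : ∀ π → part (f z) ≡ π → ∃ λ b → part (f z) ≡ inS b
        classify (inS b) fz = b , fz
        classify inB     fz = ⊥-elim (edge⇒linked (f z) (f p) (proj₂ clique z p z≢p) fz fp∈S)
        classify inA     fz = contradiction
          (trans (colour-parts (f z) (f p) fz fp∈S) (sym (colour-parts (f z) (f p′) fz fp′∈S)))
          (rainbow⇒incident-colours-≢ graph f rainbow z≢p z≢p′ p≢p′)

    rainbowClique-mate-inA : ∀ {x p p′} → f p ≡ sVertex x → p ≢ p′ → ∃ λ j → aVertex j ≡ f p′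
    rainbowClique-mate-inA {x} {p} {p′} fp≡x p≢p′
      with S-neighbour x (f p′) (subst (λ u → Edge graph u (f p′)) fp≡x (proj₂ clique p p′ p≢p′))
    ... | inj₁ fp′∈A = fp′∈A
    ... | inj₂ (_ , fp′∈S) =
      ⊥-elim (rainbowClique-S-unique p≢p′ (trans (cong part fp≡x) (part-sVertex x)) fp′∈S)

  aVertex≢sVertex : ∀ j x → aVertex j ≢ sVertex x
  aVertex≢sVertex j x e = case trans (sym (part-aVertex j)) (trans (cong part e) (part-sVertex x)) of λ ()

  -- k * k * m is a successor, so suc sizeA reduces to it.
  tileCount : sizeS * k ≡ suc sizeA
  tileCount = begin
    k * m * k    ≡⟨ ℕₚ.*-assoc k m k ⟩
    k * (m * k)  ≡⟨ cong (k *_) (ℕₚ.*-comm m k) ⟩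
    k * (k * m)  ≡⟨ ℕₚ.*-assoc k k m ⟨
    k * k * m    ∎
    where open ≡-Reasoning

  noPerfectTiling : ¬ PerfectRainbowTiling graph (suc k)
  noPerfectTiling (_ , t , rainbowCliques , t-injective , t-surjective) =
    ℕₚ.1+n≰n (subst (_≤ sizeA) tileCount
      (tileMates-count t t-injective t-surjective sVertex aVertex
                       (Finₚ.↑ʳ-injective sizeT _ _) aVertex≢sVertex mate))
    where
    mate : ∀ {x i p p′} → t i p ≡ sVertex x → p ≢ p′ → ∃ λ j → aVertex j ≡ t i p′
    mate {i = i} = rainbowClique-mate-inA (t i) (proj₁ (rainbowCliques i)) (proj₂ (rainbowCliques i))

  counterexample : Σ (ColouredGraph N) λ G → MinColourDegree G δ × ¬ PerfectRainbowTiling G (suc k)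
  counterexample = graph , minColourDegree , noPerfectTiling

-- The ring solver handles neither ∸ nor pred, so it is applied to the normal forms of both sides.
vertexCount : ∀ q m′ → Construction.N q m′ ≡ (suc (suc q) * suc (suc q) ∸ 2) * suc m′
vertexCount = normalForm
  where
  normalForm : ∀ q m′ → suc (q * suc m′ + (m′ + (q + q * suc q) * suc m′)) + suc q * suc m′
                        ≡ (q + suc q * suc (suc q)) * suc m′
  normalForm = solve-∀

minColourDegree-value : ∀ q m′ →
  Construction.δ q m′ ≡ (suc (suc q) * suc (suc q) ∸ suc (suc q) ∸ 1) * suc m′ ∸ 1
minColourDegree-value q m′ = trans (normalForm q m′)
  (cong (λ x → (x ∸ 1) * suc m′ ∸ 1) (sym (ℕₚ.m+n∸m≡n q (suc q * suc (suc q)))))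
  where
  normalForm : ∀ q m′ → q * suc m′ + (m′ + (q + q * suc q) * suc m′) ≡ m′ + (q + q * suc (suc q)) * suc m′
  normalForm = solve-∀

proposition1p4 : (r m : ℕ) → 2 ≤ r → 1 ≤ m → r ∣ m →
    Σ (ColouredGraph ((r * r ∸ 2) * m)) λ G →
      MinColourDegree G ((r * r ∸ r ∸ 1) * m ∸ 1) × ¬ PerfectRainbowTiling G r
proposition1p4 (suc (suc q)) (suc m′) _ _ _ =
  subst₂ (λ n δ → Σ (ColouredGraph n) λ G → MinColourDegree G δ × ¬ PerfectRainbowTiling G (suc (suc q)))
         (vertexCount q m′) (minColourDegree-value q m′) (Construction.counterexample q m′)
proposition1p4 (suc zero)    _        (s≤s ()) _ _
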